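{- The only rays in the Macdonald tree are $\{(n)\}_{n\ge0}$ and $\{(1^n)\}_{n\ge0}$ (i.e. the ray of one-row partitions and the ray of one-column partitions).
   Context: For a partition $\lambda$, $f_\lambda$ is the number of standard Young tableaux of shape $\lambda$; $\lambda$ is odd if $f_\lambda$ is odd. The Macdonald tree is the subgraph induced in Young's graph (Hasse diagram of partitions ordered by containment) by the odd partitions; it is a rooted tree with root $\emptyset$. A ray in the Macdonald tree is a sequence $(\lambda^{(n)})_{n\ge0}$ of odd partitions with $\lambda^{(0)}=\emptyset$ and $\lambda^{(n+1)}$ covering $\lambda^{(n)}$ (obtained from it by adding one cell) for all $n$. -}

module Defs where

open import Data.Nat using (ℕ; zero; suc; _+_; _≤_; _<_; _<ᵇ_; _%_; pred)
open import Data.Bool using (if_then_else_)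
open import Data.List using (List; []; _∷_; _++_; map; replicate; length)
open import Data.Nat.ListAction using (sum)
open import Data.List.Relation.Unary.All using (All)
open import Data.List.Relation.Binary.Pointwise using (Pointwise)
open import Data.Product using (_×_)
open import Data.Unit using (⊤)
open import Relation.Binary.PropositionalEquality using (_≡_)

-- A partition is represented by its list of (positive) row lengths,
-- weakly decreasing: λ = (λ₁ ≥ λ₂ ≥ … ≥ λₗ > 0).
Decreasing : List ℕ → Set
Decreasing []           = ⊤
Decreasing (a ∷ [])     = ⊤
Decreasing (a ∷ b ∷ xs) = (b ≤ a) × Decreasing (b ∷ xs)

IsPartition : List ℕ → Set
IsPartition λ′ = All (λ x → 0 < x) λ′ × Decreasing λ′

size : List ℕ → ℕ
size = sum

corners : List ℕ → List (List ℕ)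
corners []               = []
corners (zero ∷ [])      = []
corners (suc zero ∷ [])  = [] ∷ []
corners (suc (suc a) ∷ []) = (suc a ∷ []) ∷ []
corners (a ∷ b ∷ xs) =
  (if b <ᵇ a then (pred a ∷ b ∷ xs) ∷ [] else []) ++ map (a ∷_) (corners (b ∷ xs))

-- number of standard Young tableaux, computed by the position of the
-- largest entry (which must sit in a corner cell); the first argument is fuel.
sytCount : ℕ → List ℕ → ℕ
sytCount zero    []      = 1
sytCount zero    (_ ∷ _) = 0
sytCount (suc k) λ′      = sum (map (sytCount k) (corners λ′))

f : List ℕ → ℕ
f λ′ = sytCount (size λ′) λ′

IsOdd : List ℕ → Set
IsOdd λ′ = IsPartition λ′ × (f λ′ % 2 ≡ 1)

data _⊆ₚ_ : List ℕ → List ℕ → Set where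
  []⊆  : ∀ {λ′} → [] ⊆ₚ λ′
  ∷⊆   : ∀ {a b μ λ′} → a ≤ b → μ ⊆ₚ λ′ → (a ∷ μ) ⊆ₚ (b ∷ λ′)

_⋖_ : List ℕ → List ℕ → Set
μ ⋖ λ′ = (μ ⊆ₚ λ′) × (size λ′ ≡ suc (size μ))

IsRay : (ℕ → List ℕ) → Set
IsRay r = (r 0 ≡ []) × (∀ n → IsOdd (r n)) × (∀ n → r n ⋖ r (suc n))

rowPart : ℕ → List ℕ
rowPart zero    = []
rowPart (suc n) = suc n ∷ []

colPart : ℕ → List ℕ
colPart n = replicate n 1

-- A partition is encoded by the word of its boundary, in which removing a rim
-- hook of length k swaps a false at position i with a true at position i + k.
-- Counting standard tableaux by the position of the largest entry, f_λ mod 2 is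
-- obtained by applying |λ| times the GF(2)-linear operator removing one cell.
-- Over GF(2), removing two k-hooks in succession is the same as removing one
-- 2k-hook: pairs of commuting removals cancel, and the remaining pairs chain up
-- into a 2k-hook. So for |λ| = 2^K, f_λ is odd iff removing one 2^K-hook can
-- empty λ, i.e. iff λ is a hook. In a ray the member of size 2^(K+1) is thus a
-- hook, the member of size 2^K + 1 lies in it and is a row or a column (a hook
-- with both arm and leg has two corners, each leaving an odd hook of size 2^K),
-- and every member lies in one of these; the member of size 2 decides which.

module Submission where

open import Defs
open import Data.Nat using (ℕ; zero; suc; pred; _≤′_; ≤′-refl; ≤′-step; _+_; _∸_; _^_; _≤_; _<_; z≤n; s≤s; _%_; _<ᵇ_)
open import Data.Nat.Properties
open import Data.Bool using (Bool; true; false; not; _∧_; _xor_; T)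
open import Data.Bool.Properties
  using (xor-same; not-distribˡ-xor; not-involutive; ∧-conicalˡ; ∧-conicalʳ; xor-identityʳ; ∧-zeroʳ; ∧-identityʳ; ∧-comm; ∧-assoc; xor-∧-commutativeRing)
open import Algebra.Bundles using (CommutativeRing)
open import Algebra.Properties.CommutativeSemigroup
  (CommutativeRing.+-commutativeSemigroup xor-∧-commutativeRing) using (interchange)
open import Data.List using (List; []; _∷_; _++_; map; replicate; length; null; foldr)
open import Data.Bool.ListAction using (all)
open import Data.Nat.ListAction using (sum)
open import Data.Nat.DivMod using ([m+n]%n≡m%n)
open import Data.List.Properties using (map-∘; map-cong-local; ++-identityʳ)
open import Data.List.Relation.Unary.All as All using (All; []; _∷_)
open import Data.List.Relation.Unary.All.Properties using (map⁺)
open import Data.Unit using (⊤; tt)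
open import Data.Sum using (_⊎_; inj₁; inj₂)
open import Data.Product using (Σ; _×_; _,_; proj₁; proj₂)
open import Data.Empty using (⊥-elim)
open import Relation.Nullary using (¬_; does; yes; no)
open import Relation.Nullary.Decidable using (dec-true; dec-false)
open import Relation.Binary.PropositionalEquality
open import Function using (_∘_)

-- Sums over GF(2)

⨁ : ℕ → (ℕ → Bool) → Bool
⨁ zero    h = false
⨁ (suc N) h = h 0 xor ⨁ N (λ i → h (suc i))

syntax ⨁ N (λ i → e) = ⨁[ i < N ] e

⨁-cong : ∀ N {g h : ℕ → Bool} → (∀ i → g i ≡ h i) → ⨁ N g ≡ ⨁ N h
⨁-cong zero    g≗h = refl
⨁-cong (suc N) g≗h = cong₂ _xor_ (g≗h 0) (⨁-cong N (λ i → g≗h (suc i)))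

⨁-false : ∀ N → ⨁[ i < N ] false ≡ false
⨁-false zero    = refl
⨁-false (suc N) = ⨁-false N

⨁-xor : ∀ N (g h : ℕ → Bool) → ⨁[ i < N ] (g i xor h i) ≡ ⨁ N g xor ⨁ N h
⨁-xor zero    g h = refl
⨁-xor (suc N) g h =
  trans (cong ((g 0 xor h 0) xor_) (⨁-xor N _ _)) (interchange (g 0) (h 0) _ _)

∧-distribˡ-⨁ : ∀ N b (h : ℕ → Bool) → b ∧ ⨁ N h ≡ ⨁[ i < N ] (b ∧ h i)
∧-distribˡ-⨁ N false h = sym (⨁-false N)
∧-distribˡ-⨁ N true  h = refl

⨁-swap : ∀ N M (F : ℕ → ℕ → Bool) → ⨁[ i < N ] ⨁ M (F i) ≡ ⨁[ j < M ] ⨁[ i < N ] F i j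
⨁-swap zero    M F = sym (⨁-false M)
⨁-swap (suc N) M F =
  trans (cong (⨁ M (F 0) xor_) (⨁-swap N M (λ i → F (suc i))))
        (sym (⨁-xor M (F 0) (λ j → ⨁[ i < N ] F (suc i) j)))

⨁²-symmetric : ∀ N (F : ℕ → ℕ → Bool) → (∀ i j → F i j ≡ F j i) → (∀ i → F i i ≡ false) →
  ⨁[ i < N ] ⨁ N (F i) ≡ false
⨁²-symmetric zero    F sym-F diag-F = refl
⨁²-symmetric (suc N) F sym-F diag-F = begin
    (F 0 0 xor row) xor ⨁[ i < N ] (F (suc i) 0 xor ⨁[ j < N ] F (suc i) (suc j))
  ≡⟨ cong₂ (λ a b → (a xor row) xor b) (diag-F 0) (⨁-xor N _ _) ⟩
    row xor (⨁[ i < N ] F (suc i) 0 xor ⨁[ i < N ] ⨁[ j < N ] F (suc i) (suc j))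
  ≡⟨ cong₂ (λ a b → row xor (a xor b)) (⨁-cong N (λ i → sym-F (suc i) 0))
       (⨁²-symmetric N (λ i j → F (suc i) (suc j)) (λ i j → sym-F (suc i) (suc j)) (λ i → diag-F (suc i))) ⟩
    row xor (row xor false)
  ≡⟨ cong (row xor_) (xor-identityʳ row) ⟩
    row xor row
  ≡⟨ xor-same row ⟩
    false ∎
  where
  open ≡-Reasoning
  row = ⨁[ j < N ] F 0 (suc j)

⨁-indicator : ∀ N p c → (c ≡ true → p < N) → ⨁[ j < N ] (does (j ≟ p) ∧ c) ≡ c
⨁-indicator zero    p       false p<N = refl
⨁-indicator zero    p       true  p<N with () ← p<N refl
⨁-indicator (suc N) zero    c     p<N = trans (cong (c xor_) (⨁-false N)) (xor-identityʳ c)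
⨁-indicator (suc N) (suc p) c     p<N = ⨁-indicator N p c (λ c≡true → ≤-pred (p<N c≡true))

-- Boundary words

Word : Set
Word = List Bool

-- Out of range, a word reads as false and is padded with false when written to.
bit : Word → ℕ → Bool
bit []      _       = false
bit (x ∷ w) zero    = x
bit (x ∷ w) (suc i) = bit w i

setBit : Word → ℕ → Bool → Word
setBit []      zero    b = b ∷ []
setBit []      (suc p) b = false ∷ setBit [] p b
setBit (x ∷ w) zero    b = b ∷ w
setBit (x ∷ w) (suc p) b = x ∷ setBit w p b

bit-setBit-same : ∀ w p b → bit (setBit w p b) p ≡ b
bit-setBit-same []      zero    b = refl
bit-setBit-same []      (suc p) b = bit-setBit-same [] p b
bit-setBit-same (x ∷ w) zero    b = refl
bit-setBit-same (x ∷ w) (suc p) b = bit-setBit-same w p b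

bit-setBit-other : ∀ w {p q} b → p ≢ q → bit (setBit w p b) q ≡ bit w q
bit-setBit-other []      {zero}  {zero}  b p≢q = ⊥-elim (p≢q refl)
bit-setBit-other []      {zero}  {suc q} b p≢q = refl
bit-setBit-other []      {suc p} {zero}  b p≢q = refl
bit-setBit-other []      {suc p} {suc q} b p≢q = bit-setBit-other [] b (p≢q ∘ cong suc)
bit-setBit-other (x ∷ w) {zero}  {zero}  b p≢q = ⊥-elim (p≢q refl)
bit-setBit-other (x ∷ w) {zero}  {suc q} b p≢q = refl
bit-setBit-other (x ∷ w) {suc p} {zero}  b p≢q = refl
bit-setBit-other (x ∷ w) {suc p} {suc q} b p≢q = bit-setBit-other w b (p≢q ∘ cong suc)

setBit-comm : ∀ w {p q} a b → p ≢ q → setBit (setBit w p a) q b ≡ setBit (setBit w q b) p a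
setBit-comm []      {zero}  {zero}  a b p≢q = ⊥-elim (p≢q refl)
setBit-comm []      {zero}  {suc q} a b p≢q = refl
setBit-comm []      {suc p} {zero}  a b p≢q = refl
setBit-comm []      {suc p} {suc q} a b p≢q = cong (false ∷_) (setBit-comm [] a b (p≢q ∘ cong suc))
setBit-comm (x ∷ w) {zero}  {zero}  a b p≢q = ⊥-elim (p≢q refl)
setBit-comm (x ∷ w) {zero}  {suc q} a b p≢q = refl
setBit-comm (x ∷ w) {suc p} {zero}  a b p≢q = refl
setBit-comm (x ∷ w) {suc p} {suc q} a b p≢q = cong (x ∷_) (setBit-comm w a b (p≢q ∘ cong suc))

setBit-setBit : ∀ w p a b → setBit (setBit w p a) p b ≡ setBit w p b
setBit-setBit []      zero    a b = refl
setBit-setBit []      (suc p) a b = cong (false ∷_) (setBit-setBit [] p a b)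
setBit-setBit (x ∷ w) zero    a b = refl
setBit-setBit (x ∷ w) (suc p) a b = cong (x ∷_) (setBit-setBit w p a b)

setBit-bit : ∀ w p → p < length w → setBit w p (bit w p) ≡ w
setBit-bit (x ∷ w) zero    _         = refl
setBit-bit (x ∷ w) (suc p) (s≤s p<w) = cong (x ∷_) (setBit-bit w p p<w)

bit≡true⇒<length : ∀ w p → bit w p ≡ true → p < length w
bit≡true⇒<length (x ∷ w) zero    _ = s≤s z≤n
bit≡true⇒<length (x ∷ w) (suc p) e = s≤s (bit≡true⇒<length w p e)

length-setBit : ∀ w p b → p < length w → length (setBit w p b) ≡ length w
length-setBit (x ∷ w) zero    b _         = refl
length-setBit (x ∷ w) (suc p) b (s≤s p<w) = cong suc (length-setBit w p b p<w)

setBit-true : ∀ w p → bit w p ≡ true → setBit w p true ≡ w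
setBit-true w p e = trans (cong (setBit w p) (sym e)) (setBit-bit w p (bit≡true⇒<length w p e))

setBit-false : ∀ w p → p < length w → bit w p ≡ false → setBit w p false ≡ w
setBit-false w p p<w e = trans (cong (setBit w p) (sym e)) (setBit-bit w p p<w)

ones : Word → ℕ
ones []          = 0
ones (true ∷ w)  = suc (ones w)
ones (false ∷ w) = ones w

prependRow : ℕ → List ℕ → List ℕ
prependRow zero    rs = rs
prependRow (suc c) rs = suc c ∷ rs

-- Each false is a row whose length is the number of trues after it (empty
-- rows dropped); removing a corner cell turns a factor false ∷ true into true ∷ false.
shape : Word → List ℕ
shape []          = []
shape (true ∷ w)  = shape w
shape (false ∷ w) = prependRow (ones w) (shape w)

cellRemovals : Word → List Word
cellRemovals []                  = []
cellRemovals (true ∷ u)          = map (true ∷_) (cellRemovals u)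
cellRemovals (false ∷ [])        = []
cellRemovals (false ∷ true ∷ u)  = (true ∷ false ∷ u) ∷ map (false ∷_) (cellRemovals (true ∷ u))
cellRemovals (false ∷ false ∷ u) = map (false ∷_) (cellRemovals (false ∷ u))

ones-cellRemovals : ∀ w → All (λ v → ones v ≡ ones w) (cellRemovals w)
ones-cellRemovals []                  = []
ones-cellRemovals (true ∷ u)          = map⁺ (All.map (cong suc) (ones-cellRemovals u))
ones-cellRemovals (false ∷ [])        = []
ones-cellRemovals (false ∷ true ∷ u)  = refl ∷ map⁺ (ones-cellRemovals (true ∷ u))
ones-cellRemovals (false ∷ false ∷ u) = map⁺ (ones-cellRemovals (false ∷ u))

shape-ones≡0 : ∀ w → ones w ≡ 0 → shape w ≡ []
shape-ones≡0 []          _ = refl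
shape-ones≡0 (false ∷ w) e rewrite e = shape-ones≡0 w e

FirstRow≤ : ℕ → List ℕ → Set
FirstRow≤ c []      = ⊤
FirstRow≤ c (b ∷ _) = 0 < b × b ≤ c

FirstRow≤-suc : ∀ c R → FirstRow≤ c R → FirstRow≤ (suc c) R
FirstRow≤-suc c []      _           = tt
FirstRow≤-suc c (b ∷ _) (0<b , b≤c) = 0<b , m≤n⇒m≤1+n b≤c

shape-firstRow : ∀ w → FirstRow≤ (ones w) (shape w)
shape-firstRow []          = tt
shape-firstRow (true ∷ w)  = FirstRow≤-suc (ones w) (shape w) (shape-firstRow w)
shape-firstRow (false ∷ w) with ones w | shape-firstRow w
... | zero  | first = first
... | suc c | _     = s≤s z≤n , ≤-refl

n<ᵇn≡false : ∀ n → (n <ᵇ n) ≡ false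
n<ᵇn≡false zero    = refl
n<ᵇn≡false (suc n) = n<ᵇn≡false n

corners-∷ : ∀ c R → FirstRow≤ c R → corners (suc c ∷ R) ≡ prependRow c R ∷ map (suc c ∷_) (corners R)
corners-∷ zero    []      _           = refl
corners-∷ (suc c) []      _           = refl
corners-∷ zero    (b ∷ R) (0<b , b≤0) = ⊥-elim (<-irrefl refl (≤-trans 0<b b≤0))
corners-∷ (suc c) (b ∷ R) (_ , b≤c) with b <ᵇ suc (suc c) in b<?c
... | true  = refl
... | false = ⊥-elim (subst T b<?c (<⇒<ᵇ (s≤s b≤c)))

-- The first of two equal rows has no corner.
corners-equalRows : ∀ c R → (c ≡ 0 → R ≡ []) →
  map (prependRow c) (corners (prependRow c R)) ≡ corners (prependRow c (prependRow c R))
corners-equalRows zero          R c≡0 rewrite c≡0 refl = refl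
corners-equalRows (suc zero)    R _                    = refl
corners-equalRows (suc (suc c)) R _ rewrite n<ᵇn≡false c = refl

map-shape-false∷ : ∀ w →
  map (shape ∘ (false ∷_)) (cellRemovals w) ≡ map (prependRow (ones w)) (map shape (cellRemovals w))
map-shape-false∷ w =
  trans (map-cong-local (All.map (λ {v} e → cong (λ n → prependRow n (shape v)) e) (ones-cellRemovals w)))
        (map-∘ (cellRemovals w))

map-shape-cellRemovals : ∀ w → map shape (cellRemovals w) ≡ corners (shape w)
map-shape-cellRemovals []          = refl
map-shape-cellRemovals (true ∷ u)  = trans (sym (map-∘ (cellRemovals u))) (map-shape-cellRemovals u)
map-shape-cellRemovals (false ∷ []) = refl
map-shape-cellRemovals (false ∷ w@(true ∷ u)) = begin
    prependRow (ones u) (shape u) ∷ map shape (map (false ∷_) (cellRemovals w))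
  ≡⟨ cong (prependRow (ones u) (shape u) ∷_) (trans (sym (map-∘ (cellRemovals w))) (map-shape-false∷ w)) ⟩
    prependRow (ones u) (shape u) ∷ map (suc (ones u) ∷_) (map shape (cellRemovals w))
  ≡⟨ cong (λ cs → prependRow (ones u) (shape u) ∷ map (suc (ones u) ∷_) cs) (map-shape-cellRemovals w) ⟩
    prependRow (ones u) (shape u) ∷ map (suc (ones u) ∷_) (corners (shape u))
  ≡⟨ sym (corners-∷ (ones u) (shape u) (shape-firstRow u)) ⟩
    corners (shape (false ∷ w)) ∎
  where open ≡-Reasoning
map-shape-cellRemovals (false ∷ w@(false ∷ u)) = begin
    map shape (map (false ∷_) (cellRemovals w))
  ≡⟨ trans (sym (map-∘ (cellRemovals w))) (map-shape-false∷ w) ⟩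
    map (prependRow (ones u)) (map shape (cellRemovals w))
  ≡⟨ cong (map (prependRow (ones u))) (map-shape-cellRemovals w) ⟩
    map (prependRow (ones u)) (corners (prependRow (ones u) (shape u)))
  ≡⟨ corners-equalRows (ones u) (shape u) (shape-ones≡0 u) ⟩
    corners (shape (false ∷ w)) ∎
  where open ≡-Reasoning

-- Removing rim hooks

-- Swapping a false at i with a true at i + k removes a rim hook of length k from the shape.
removable : ℕ → Word → ℕ → Bool
removable k w i = bit w (i + k) ∧ not (bit w i)

removeHook : ℕ → Word → ℕ → Word
removeHook k w i = setBit (setBit w i true) (i + k) false

hookOp : ℕ → ℕ → (Word → Bool) → Word → Bool
hookOp N k g w = ⨁[ i < N ] (removable k w i ∧ g (removeHook k w i))

module HookOpSquare (N k : ℕ) (0<k : 0 < k) (g : Word → Bool) (w : Word) where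

  i≢i+k : ∀ i → i ≢ i + k
  i≢i+k i = <⇒≢ (m<m+n i 0<k)

  i≢i+k+k : ∀ i → i ≢ i + k + k
  i≢i+k+k i = <⇒≢ (<-≤-trans (m<m+n i 0<k) (m≤m+n (i + k) k))

  w₁ : ℕ → Word
  w₁ i = removeHook k w i

  twice : ℕ → ℕ → Bool
  twice i j = removable k w i ∧ (removable k (w₁ i) j ∧ g (removeHook k (w₁ i) j))

  -- Two consecutive removals with j = i + k, or i = j + k, remove a single
  -- 2k-hook; which of the two happens is decided by the middle bit.
  removeChain : ℕ → Word
  removeChain i = setBit (setBit w i true) (i + k + k) false

  chainFull : ℕ → Bool
  chainFull i = removable k w i ∧ (bit w (i + k + k) ∧ g (removeChain i))

  chainEmpty : ℕ → Bool
  chainEmpty j = removable k w (j + k) ∧ (not (bit w j) ∧ g (removeChain j))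

  separated : ℕ → ℕ → Bool
  separated i j = not (does (j ≟ i)) ∧ (not (does (j ≟ i + k)) ∧ not (does (i ≟ j + k)))

  twiceApart : ℕ → ℕ → Bool
  twiceApart i j = (removable k w i ∧ removable k w j) ∧ g (removeHook k (w₁ i) j)

  -- Away from the chains the two removals commute, so these terms cancel in pairs.
  twiceSeparated : ℕ → ℕ → Bool
  twiceSeparated i j = separated i j ∧ twiceApart i j

  twice-diagonal : ∀ i → twice i i ≡ false
  twice-diagonal i = begin
      removable k w i ∧ ((bit (w₁ i) (i + k) ∧ not (bit (w₁ i) i)) ∧ g (removeHook k (w₁ i) i))
    ≡⟨ cong (λ b → removable k w i ∧ ((bit (w₁ i) (i + k) ∧ not b) ∧ g (removeHook k (w₁ i) i)))
         (trans (bit-setBit-other (setBit w i true) false (≢-sym (i≢i+k i))) (bit-setBit-same w i true)) ⟩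
      removable k w i ∧ ((bit (w₁ i) (i + k) ∧ false) ∧ g (removeHook k (w₁ i) i))
    ≡⟨ cong (λ b → removable k w i ∧ (b ∧ g (removeHook k (w₁ i) i))) (∧-zeroʳ _) ⟩
      removable k w i ∧ false
    ≡⟨ ∧-zeroʳ _ ⟩
      false ∎
    where open ≡-Reasoning

  twice-next : ∀ i → twice i (i + k) ≡ chainFull i
  twice-next i with bit w (i + k) in i+k∈w
  ... | false = refl
  ... | true  = cong (not (bit w i) ∧_) (cong₂ _∧_ (trans bits (∧-identityʳ _)) (cong g words))
    where
    bits : bit (w₁ i) (i + k + k) ∧ not (bit (w₁ i) (i + k)) ≡ bit w (i + k + k) ∧ true
    bits = cong₂ (λ a b → a ∧ not b)
      (trans (bit-setBit-other (setBit w i true) false (i≢i+k (i + k)))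
             (bit-setBit-other w true (i≢i+k+k i)))
      (bit-setBit-same (setBit w i true) (i + k) false)
    words : removeHook k (w₁ i) (i + k) ≡ removeChain i
    words = cong (λ v → setBit v (i + k + k) false)
      (trans (setBit-setBit (setBit w i true) (i + k) false true)
        (setBit-true (setBit w i true) (i + k) (trans (bit-setBit-other w true (i≢i+k i)) i+k∈w)))

  twice-prev : ∀ j → twice (j + k) j ≡ chainEmpty j
  twice-prev j with bit w (j + k + k) in j+2k∈w | bit w (j + k) in j+k∈w
  ... | false | _     = refl
  ... | true  | true  = refl
  ... | true  | false = cong₂ _∧_ bits (cong g words)
    where
    p = j + k
    q = j + k + k
    bits : bit (w₁ p) p ∧ not (bit (w₁ p) j) ≡ not (bit w j)
    bits = cong₂ (λ a b → a ∧ not b)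
      (trans (bit-setBit-other (setBit w p true) false (≢-sym (i≢i+k p))) (bit-setBit-same w p true))
      (trans (bit-setBit-other (setBit w p true) false (≢-sym (i≢i+k+k j)))
             (bit-setBit-other w true (≢-sym (i≢i+k j))))
    p<w : p < length w
    p<w = ≤-<-trans (m≤m+n p k) (bit≡true⇒<length w q j+2k∈w)
    words : removeHook k (w₁ p) j ≡ removeChain j
    words = begin
        setBit (setBit (setBit (setBit w p true) q false) j true) p false
      ≡⟨ cong (λ v → setBit v p false) (setBit-comm (setBit w p true) false true (≢-sym (i≢i+k+k j))) ⟩
        setBit (setBit (setBit (setBit w p true) j true) q false) p false
      ≡⟨ setBit-comm (setBit (setBit w p true) j true) false false (≢-sym (i≢i+k p)) ⟩
        setBit (setBit (setBit (setBit w p true) j true) p false) q false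
      ≡⟨ cong (λ v → setBit (setBit v p false) q false) (setBit-comm w true true (≢-sym (i≢i+k j))) ⟩
        setBit (setBit (setBit (setBit w j true) p true) p false) q false
      ≡⟨ cong (λ v → setBit v q false) (setBit-setBit (setBit w j true) p true false) ⟩
        setBit (setBit (setBit w j true) p false) q false
      ≡⟨ cong (λ v → setBit v q false) (setBit-comm w true false (i≢i+k j)) ⟩
        setBit (setBit (setBit w p false) j true) q false
      ≡⟨ cong (λ v → setBit (setBit v j true) q false) (setBit-false w p p<w j+k∈w) ⟩
        removeChain j ∎
      where open ≡-Reasoning

  module _ {i j : ℕ} (j≢i : j ≢ i) (j≢i+k : j ≢ i + k) (i≢j+k : i ≢ j + k) where

    twice-apart : twice i j ≡ twiceApart i j
    twice-apart = trans (cong (λ b → removable k w i ∧ (b ∧ g (removeHook k (w₁ i) j))) unchanged)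
                        (sym (∧-assoc (removable k w i) (removable k w j) _))
      where
      unchanged : removable k (w₁ i) j ≡ removable k w j
      unchanged = cong₂ (λ a b → a ∧ not b)
        (trans (bit-setBit-other (setBit w i true) false (j≢i ∘ +-cancelʳ-≡ k j i ∘ sym))
               (bit-setBit-other w true i≢j+k))
        (trans (bit-setBit-other (setBit w i true) false (≢-sym j≢i+k))
               (bit-setBit-other w true (≢-sym j≢i)))

    separated-apart : separated i j ≡ true
    separated-apart rewrite dec-false (j ≟ i) j≢i | dec-false (j ≟ i + k) j≢i+k
                          | dec-false (i ≟ j + k) i≢j+k = refl

    removeHook-twice-comm : removeHook k (w₁ i) j ≡ removeHook k (w₁ j) i
    removeHook-twice-comm = begin
        setBit (setBit (setBit (setBit w i true) (i + k) false) j true) (j + k) false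
      ≡⟨ cong (λ v → setBit v (j + k) false) (setBit-comm (setBit w i true) false true (≢-sym j≢i+k)) ⟩
        setBit (setBit (setBit (setBit w i true) j true) (i + k) false) (j + k) false
      ≡⟨ cong (λ v → setBit (setBit v (i + k) false) (j + k) false) (setBit-comm w true true (≢-sym j≢i)) ⟩
        setBit (setBit (setBit (setBit w j true) i true) (i + k) false) (j + k) false
      ≡⟨ setBit-comm (setBit (setBit w j true) i true) false false (j≢i ∘ +-cancelʳ-≡ k j i ∘ sym) ⟩
        setBit (setBit (setBit (setBit w j true) i true) (j + k) false) (i + k) false
      ≡⟨ cong (λ v → setBit v (i + k) false) (setBit-comm (setBit w j true) true false i≢j+k) ⟩
        setBit (setBit (setBit (setBit w j true) (j + k) false) i true) (i + k) false ∎
      where open ≡-Reasoning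

  separated-next : ∀ i → separated i (i + k) ≡ false
  separated-next i rewrite dec-true ((i + k) ≟ i + k) refl = ∧-zeroʳ _

  separated-prev : ∀ j → separated (j + k) j ≡ false
  separated-prev j rewrite dec-true ((j + k) ≟ j + k) refl = trans (cong (not (does (j ≟ j + k)) ∧_) (∧-zeroʳ _)) (∧-zeroʳ _)

  twiceSeparated-diagonal : ∀ i → twiceSeparated i i ≡ false
  twiceSeparated-diagonal i rewrite dec-true (i ≟ i) refl = refl

  twiceSeparated-next : ∀ i → twiceSeparated i (i + k) ≡ false
  twiceSeparated-next i = cong (_∧ twiceApart i (i + k)) (separated-next i)

  twiceSeparated-prev : ∀ j → twiceSeparated (j + k) j ≡ false
  twiceSeparated-prev j = cong (_∧ twiceApart (j + k) j) (separated-prev j)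

  twice-split : ∀ i j → twice i j ≡
    twiceSeparated i j xor ((does (j ≟ i + k) ∧ chainFull i) xor (does (i ≟ j + k) ∧ chainEmpty j))
  twice-split i j with j ≟ i
  ... | yes refl rewrite twiceSeparated-diagonal i | dec-false (i ≟ i + k) (i≢i+k i) = twice-diagonal i
  ... | no j≢i with j ≟ i + k
  ...   | yes refl rewrite twiceSeparated-next i | dec-true ((i + k) ≟ i + k) refl
                         | dec-false (i ≟ i + k + k) (i≢i+k+k i) =
    trans (twice-next i) (sym (xor-identityʳ _))
  ...   | no j≢i+k with i ≟ j + k
  ...     | yes refl rewrite twiceSeparated-prev j | dec-false (j ≟ j + k + k) (i≢i+k+k j)
                           | dec-true ((j + k) ≟ j + k) refl = twice-prev j
  ...     | no i≢j+k rewrite separated-apart j≢i j≢i+k i≢j+k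
                         | dec-false (j ≟ i + k) j≢i+k | dec-false (i ≟ j + k) i≢j+k =
    trans (twice-apart j≢i j≢i+k i≢j+k) (sym (xor-identityʳ _))

  twiceSeparated-sym : ∀ i j → twiceSeparated i j ≡ twiceSeparated j i
  twiceSeparated-sym i j with j ≟ i
  ... | yes refl = refl
  ... | no j≢i with j ≟ i + k
  ...   | yes refl = trans (twiceSeparated-next i) (sym (twiceSeparated-prev i))
  ...   | no j≢i+k with i ≟ j + k
  ...     | yes refl = trans (twiceSeparated-prev j) (sym (twiceSeparated-next j))
  ...     | no i≢j+k = begin
      separated i j ∧ twiceApart i j
    ≡⟨ cong (_∧ twiceApart i j) (separated-apart j≢i j≢i+k i≢j+k) ⟩
      (removable k w i ∧ removable k w j) ∧ g (removeHook k (w₁ i) j)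
    ≡⟨ cong₂ (λ a v → a ∧ g v) (∧-comm (removable k w i) (removable k w j))
         (removeHook-twice-comm j≢i j≢i+k i≢j+k) ⟩
      twiceApart j i
    ≡⟨ cong (_∧ twiceApart j i) (sym (separated-apart (≢-sym j≢i) i≢j+k j≢i+k)) ⟩
      separated j i ∧ twiceApart j i ∎
    where open ≡-Reasoning

  chainFull-xor-chainEmpty : ∀ i →
    chainFull i xor chainEmpty i ≡ removable (k + k) w i ∧ g (removeHook (k + k) w i)
  chainFull-xor-chainEmpty i =
    subst (λ p → chainFull i xor chainEmpty i ≡ (bit w p ∧ not (bit w i)) ∧ g (setBit (setBit w i true) p false))
          (+-assoc i k k)
          (middle (bit w (i + k)) (bit w i) (bit w (i + k + k)) (g (removeChain i)))
    where
    middle : ∀ m a e x → ((m ∧ not a) ∧ (e ∧ x)) xor ((e ∧ not m) ∧ (not a ∧ x)) ≡ (e ∧ not a) ∧ x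
    middle false a     false x = refl
    middle false a     true  x = refl
    middle true  false false x = refl
    middle true  false true  x = xor-identityʳ x
    middle true  true  false x = refl
    middle true  true  true  x = refl

  module _ (w≤N : length w ≤ N) where

    chainFull⇒< : ∀ i → chainFull i ≡ true → i + k < N
    chainFull⇒< i full with bit w (i + k) in i+k∈w
    ... | true = ≤-trans (bit≡true⇒<length w (i + k) i+k∈w) w≤N

    chainEmpty⇒< : ∀ j → chainEmpty j ≡ true → j + k < N
    chainEmpty⇒< j empty with bit w (j + k + k) in j+2k∈w
    ... | true = <-≤-trans (<-trans (m<m+n (j + k) 0<k) (bit≡true⇒<length w (j + k + k) j+2k∈w)) w≤N

    square : hookOp N k (hookOp N k g) w ≡ hookOp N (k + k) g w
    square = begin
        ⨁[ i < N ] (removable k w i ∧ ⨁[ j < N ] (removable k (w₁ i) j ∧ g (removeHook k (w₁ i) j)))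
      ≡⟨ ⨁-cong N (λ i → trans (∧-distribˡ-⨁ N (removable k w i) _) (⨁-cong N (twice-split i))) ⟩
        ⨁[ i < N ] ⨁[ j < N ] (twiceSeparated i j xor (full i j xor empty i j))
      ≡⟨ ⨁-cong N (λ i → trans (⨁-xor N (twiceSeparated i) _) (cong (⨁ N (twiceSeparated i) xor_) (⨁-xor N (full i) (empty i)))) ⟩
        ⨁[ i < N ] (⨁ N (twiceSeparated i) xor (⨁ N (full i) xor ⨁ N (empty i)))
      ≡⟨ trans (⨁-xor N _ _) (cong (⨁[ i < N ] ⨁ N (twiceSeparated i) xor_) (⨁-xor N _ _)) ⟩
        ⨁[ i < N ] ⨁ N (twiceSeparated i) xor (⨁[ i < N ] ⨁ N (full i) xor ⨁[ i < N ] ⨁ N (empty i))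
      ≡⟨ cong₂ (λ a b → a xor (⨁[ i < N ] ⨁ N (full i) xor b))
           (⨁²-symmetric N twiceSeparated twiceSeparated-sym twiceSeparated-diagonal) (⨁-swap N N empty) ⟩
        ⨁[ i < N ] ⨁ N (full i) xor ⨁[ j < N ] ⨁[ i < N ] empty i j
      ≡⟨ cong₂ _xor_ (⨁-cong N (λ i → ⨁-indicator N (i + k) (chainFull i) (chainFull⇒< i)))
                     (⨁-cong N (λ j → ⨁-indicator N (j + k) (chainEmpty j) (chainEmpty⇒< j))) ⟩
        ⨁ N chainFull xor ⨁ N chainEmpty
      ≡⟨ sym (⨁-xor N chainFull chainEmpty) ⟩
        ⨁[ i < N ] (chainFull i xor chainEmpty i)
      ≡⟨ ⨁-cong N chainFull-xor-chainEmpty ⟩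
        hookOp N (k + k) g w ∎
      where
      open ≡-Reasoning
      full empty : ℕ → ℕ → Bool
      full  i j = does (j ≟ i + k) ∧ chainFull i
      empty i j = does (i ≟ j + k) ∧ chainEmpty j

hookOp-square : ∀ N k → 0 < k → ∀ g w → length w ≤ N → hookOp N k (hookOp N k g) w ≡ hookOp N (k + k) g w
hookOp-square N k 0<k g w = HookOpSquare.square N k 0<k g w

hookOp₁^ : ℕ → ℕ → (Word → Bool) → Word → Bool
hookOp₁^ N zero    g = g
hookOp₁^ N (suc m) g = hookOp N 1 (hookOp₁^ N m g)

length-removeHook : ∀ k w i → bit w (i + k) ≡ true → length (removeHook k w i) ≡ length w
length-removeHook k w i i+k∈w =
  trans (length-setBit (setBit w i true) (i + k) false (subst (i + k <_) (sym (length-setBit w i true i<w)) i+k<w))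
        (length-setBit w i true i<w)
  where
  i+k<w = bit≡true⇒<length w (i + k) i+k∈w
  i<w = ≤-<-trans (m≤m+n i k) i+k<w

hookOp-cong : ∀ N k {g h : Word → Bool} → (∀ u → length u ≤ N → g u ≡ h u) →
  ∀ w → length w ≤ N → hookOp N k g w ≡ hookOp N k h w
hookOp-cong N k {g} {h} g≗h w w≤N = ⨁-cong N term
  where
  term : ∀ i → removable k w i ∧ g (removeHook k w i) ≡ removable k w i ∧ h (removeHook k w i)
  term i with bit w (i + k) in i+k∈w
  ... | false = refl
  ... | true  = cong (not (bit w i) ∧_)
    (g≗h (removeHook k w i) (subst (_≤ N) (sym (length-removeHook k w i i+k∈w)) w≤N))

hookOp₁^-+ : ∀ N m n g u → length u ≤ N → hookOp₁^ N (m + n) g u ≡ hookOp₁^ N m (hookOp₁^ N n g) u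
hookOp₁^-+ N zero    n g u u≤N = refl
hookOp₁^-+ N (suc m) n g u u≤N = hookOp-cong N 1 (hookOp₁^-+ N m n g) u u≤N

hookOp₁^-2^ : ∀ N K g u → length u ≤ N → hookOp₁^ N (2 ^ K) g u ≡ hookOp N (2 ^ K) g u
hookOp₁^-2^ N zero    g u u≤N = refl
hookOp₁^-2^ N (suc K) g u u≤N = begin
    hookOp₁^ N (k + (k + 0)) g u
  ≡⟨ cong (λ m → hookOp₁^ N (k + m) g u) (+-identityʳ k) ⟩
    hookOp₁^ N (k + k) g u
  ≡⟨ hookOp₁^-+ N k k g u u≤N ⟩
    hookOp₁^ N k (hookOp₁^ N k g) u
  ≡⟨ hookOp₁^-2^ N K _ u u≤N ⟩
    hookOp N k (hookOp₁^ N k g) u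
  ≡⟨ hookOp-cong N k (hookOp₁^-2^ N K g) u u≤N ⟩
    hookOp N k (hookOp N k g) u
  ≡⟨ hookOp-square N k (m^n>0 2 K) g u u≤N ⟩
    hookOp N (k + k) g u
  ≡⟨ cong (λ m → hookOp N (k + m) g u) (sym (+-identityʳ k)) ⟩
    hookOp N (k + (k + 0)) g u ∎
  where
  open ≡-Reasoning
  k = 2 ^ K

-- The parity of f

parity : ℕ → Bool
parity zero    = false
parity (suc n) = not (parity n)

parity-+ : ∀ m n → parity (m + n) ≡ parity m xor parity n
parity-+ zero    n = refl
parity-+ (suc m) n = trans (cong not (parity-+ m n)) (not-distribˡ-xor (parity m) (parity n))

%2≡1⇒parity : ∀ n → n % 2 ≡ 1 → parity n ≡ true
%2≡1⇒parity (suc zero)    _ = refl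
%2≡1⇒parity (suc (suc n)) e =
  trans (not-involutive (parity n)) (%2≡1⇒parity n (trans (sym ([m+n]%n≡m%n n 2)) (trans (cong (_% 2) (+-comm n 2)) e)))

⨁ˡ : List Bool → Bool
⨁ˡ = foldr _xor_ false

parity-sum : ∀ ns → parity (sum ns) ≡ ⨁ˡ (map parity ns)
parity-sum []       = refl
parity-sum (n ∷ ns) = trans (parity-+ n (sum ns)) (cong (parity n xor_) (parity-sum ns))

⨁ˡ-cellRemovals : ∀ N h w → length w ≤ N → ⨁ˡ (map h (cellRemovals w)) ≡ hookOp N 1 h w
⨁ˡ-cellRemovals N       h []                  _         = sym (⨁-false N)
⨁ˡ-cellRemovals (suc N) h (true ∷ u)          (s≤s u≤N) = begin
    ⨁ˡ (map h (map (true ∷_) (cellRemovals u)))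
  ≡⟨ cong ⨁ˡ (sym (map-∘ (cellRemovals u))) ⟩
    ⨁ˡ (map (h ∘ (true ∷_)) (cellRemovals u))
  ≡⟨ ⨁ˡ-cellRemovals N (h ∘ (true ∷_)) u u≤N ⟩
    hookOp N 1 (h ∘ (true ∷_)) u
  ≡⟨ cong (λ b → (b ∧ h (removeHook 1 (true ∷ u) 0)) xor hookOp N 1 (h ∘ (true ∷_)) u) (sym (∧-zeroʳ (bit u 0))) ⟩
    hookOp (suc N) 1 h (true ∷ u) ∎
  where open ≡-Reasoning
⨁ˡ-cellRemovals (suc N) h (false ∷ [])        _         = sym (⨁-false N)
⨁ˡ-cellRemovals (suc N) h (false ∷ true ∷ u)  (s≤s u≤N) =
  cong (h (true ∷ false ∷ u) xor_)
    (trans (cong ⨁ˡ (sym (map-∘ (cellRemovals (true ∷ u))))) (⨁ˡ-cellRemovals N (h ∘ (false ∷_)) (true ∷ u) u≤N))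
⨁ˡ-cellRemovals (suc N) h (false ∷ false ∷ u) (s≤s u≤N) =
  trans (cong ⨁ˡ (sym (map-∘ (cellRemovals (false ∷ u))))) (⨁ˡ-cellRemovals N (h ∘ (false ∷_)) (false ∷ u) u≤N)

descending : Word → Bool
descending []          = true
descending (true ∷ u)  = descending u
descending (false ∷ u) = all not u

null-prependRow-twice : ∀ c R → null (prependRow c (prependRow c R)) ≡ null (prependRow c R)
null-prependRow-twice zero    R = refl
null-prependRow-twice (suc c) R = refl

null-shape-false∷ : ∀ u → null (shape (false ∷ u)) ≡ all not u
null-shape-false∷ []          = refl
null-shape-false∷ (true ∷ u)  = refl
null-shape-false∷ (false ∷ u) = trans (null-prependRow-twice (ones u) (shape u)) (null-shape-false∷ u)

parity-sytCount₀ : ∀ u → parity (sytCount 0 (shape u)) ≡ descending u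
parity-sytCount₀ u = trans (parity-sytCount₀-null (shape u)) (null-shape u)
  where
  parity-sytCount₀-null : ∀ l → parity (sytCount 0 l) ≡ null l
  parity-sytCount₀-null []      = refl
  parity-sytCount₀-null (_ ∷ _) = refl
  null-shape : ∀ u → null (shape u) ≡ descending u
  null-shape []          = refl
  null-shape (true ∷ u)  = null-shape u
  null-shape (false ∷ u) = null-shape-false∷ u

parity-sytCount : ∀ N m u → length u ≤ N → parity (sytCount m (shape u)) ≡ hookOp₁^ N m descending u
parity-sytCount N zero    u u≤N = parity-sytCount₀ u
parity-sytCount N (suc m) u u≤N = begin
    parity (sum (map (sytCount m) (corners (shape u))))
  ≡⟨ cong (λ l → parity (sum (map (sytCount m) l))) (sym (map-shape-cellRemovals u)) ⟩
    parity (sum (map (sytCount m) (map shape (cellRemovals u))))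
  ≡⟨ parity-sum (map (sytCount m) (map shape (cellRemovals u))) ⟩
    ⨁ˡ (map parity (map (sytCount m) (map shape (cellRemovals u))))
  ≡⟨ cong ⨁ˡ (trans (sym (map-∘ _)) (sym (map-∘ (cellRemovals u)))) ⟩
    ⨁ˡ (map (λ v → parity (sytCount m (shape v))) (cellRemovals u))
  ≡⟨ ⨁ˡ-cellRemovals N _ u u≤N ⟩
    hookOp N 1 (λ v → parity (sytCount m (shape v))) u
  ≡⟨ hookOp-cong N 1 (λ v → parity-sytCount N m v) u u≤N ⟩
    hookOp N 1 (hookOp₁^ N m descending) u ∎
  where open ≡-Reasoning

parity-f-2^ : ∀ K w {μ} → shape w ≡ μ → size μ ≡ 2 ^ K → parity (f μ) ≡ hookOp (length w) (2 ^ K) descending w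
parity-f-2^ K w refl |μ|≡2^K rewrite |μ|≡2^K =
  trans (parity-sytCount (length w) (2 ^ K) w ≤-refl) (hookOp₁^-2^ (length w) K descending w ≤-refl)

-- Odd partitions of size 2^K

all-not-bit : ∀ u p → bit u p ≡ true → all not u ≡ false
all-not-bit (true ∷ u)  zero    _ = refl
all-not-bit (true ∷ u)  (suc p) _ = refl
all-not-bit (false ∷ u) (suc p) e = all-not-bit u p e

-- Only the hook starting in the first row can leave an empty shape behind.
hookOp-descending-false∷ : ∀ N k w →
  hookOp (suc N) (suc k) descending (false ∷ w) ≡ bit w k ∧ descending (setBit w k false)
hookOp-descending-false∷ N k w = begin
    ((bit w k ∧ true) ∧ descending (setBit w k false)) xor ⨁ N later
  ≡⟨ cong₂ _xor_ (cong (_∧ descending (setBit w k false)) (∧-identityʳ (bit w k)))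
                 (trans (⨁-cong N laterVanishes) (⨁-false N)) ⟩
    (bit w k ∧ descending (setBit w k false)) xor false
  ≡⟨ xor-identityʳ _ ⟩
    bit w k ∧ descending (setBit w k false) ∎
  where
  open ≡-Reasoning
  later : ℕ → Bool
  later i = removable (suc k) (false ∷ w) (suc i) ∧ descending (removeHook (suc k) (false ∷ w) (suc i))
  laterVanishes : ∀ i → later i ≡ false
  laterVanishes i = trans (cong (removable (suc k) (false ∷ w) (suc i) ∧_)
                                (all-not-bit (removeHook (suc k) w i) i set))
                          (∧-zeroʳ _)
    where
    set : bit (removeHook (suc k) w i) i ≡ true
    set = trans (bit-setBit-other (setBit w i true) false (≢-sym (<⇒≢ (m<m+n i (s≤s z≤n)))))
                (bit-setBit-same w i true)

IsHook : List ℕ → Set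
IsHook μ = Σ ℕ λ a → Σ ℕ λ b → μ ≡ suc a ∷ replicate b 1

ones-all-not : ∀ u → all not u ≡ true → ones u ≡ 0
ones-all-not []          _ = refl
ones-all-not (false ∷ u) e = ones-all-not u e

shape-descending : ∀ u → descending u ≡ true → shape u ≡ []
shape-descending []          _ = refl
shape-descending (true ∷ u)  e = shape-descending u e
shape-descending (false ∷ u) e rewrite ones-all-not u e = shape-ones≡0 u (ones-all-not u e)

ones-setBit-all-not : ∀ u m → all not u ≡ true → ones (setBit u m true) ≡ 1
ones-setBit-all-not []          zero    _ = refl
ones-setBit-all-not []          (suc m) _ = ones-setBit-all-not [] m refl
ones-setBit-all-not (false ∷ u) zero    e = cong suc (ones-all-not u e)
ones-setBit-all-not (false ∷ u) (suc m) e = ones-setBit-all-not u m e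

all-not⇒descending : ∀ u → all not u ≡ true → descending u ≡ true
all-not⇒descending []          _ = refl
all-not⇒descending (false ∷ u) e = e

shape-setBit-descending : ∀ u m → descending u ≡ true → Σ ℕ λ c → shape (setBit u m true) ≡ replicate c 1
shape-setBit-descending []          zero    _ = 0 , refl
shape-setBit-descending []          (suc m) _ with shape-setBit-descending [] m refl
... | c , column rewrite ones-setBit-all-not [] m refl = suc c , cong (1 ∷_) column
shape-setBit-descending (true ∷ u)  zero    e = 0 , shape-descending u e
shape-setBit-descending (true ∷ u)  (suc m) e = shape-setBit-descending u m e
shape-setBit-descending (false ∷ u) zero    e = 0 , shape-descending u (all-not⇒descending u e)
shape-setBit-descending (false ∷ u) (suc m) e with shape-setBit-descending u m (all-not⇒descending u e)
... | c , column rewrite ones-setBit-all-not u m e = suc c , cong (1 ∷_) column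

bit⇒ones-suc : ∀ u p → bit u p ≡ true → Σ ℕ λ c → ones u ≡ suc c
bit⇒ones-suc (true ∷ u)  zero    _ = ones u , refl
bit⇒ones-suc (true ∷ u)  (suc p) e = let (c , eq) = bit⇒ones-suc u p e in suc c , cong suc eq
bit⇒ones-suc (false ∷ u) (suc p) e = bit⇒ones-suc u p e

isHook-shape-false∷ : ∀ k w → bit w k ∧ descending (setBit w k false) ≡ true → IsHook (shape (false ∷ w))
isHook-shape-false∷ k w survives = proj₁ ones≡1+a , proj₁ column , (begin
    prependRow (ones w) (shape w)
  ≡⟨ cong (prependRow (ones w) ∘ shape) (sym restored) ⟩
    prependRow (ones w) (shape (setBit (setBit w k false) k true))
  ≡⟨ cong₂ prependRow (proj₂ ones≡1+a) (proj₂ column) ⟩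
    suc (proj₁ ones≡1+a) ∷ replicate (proj₁ column) 1 ∎)
  where
  open ≡-Reasoning
  k∈w : bit w k ≡ true
  k∈w = ∧-conicalˡ _ _ survives
  ones≡1+a = bit⇒ones-suc w k k∈w
  column = shape-setBit-descending (setBit w k false) k (∧-conicalʳ _ _ survives)
  restored : setBit (setBit w k false) k true ≡ w
  restored = trans (setBit-setBit w k false true) (setBit-true w k k∈w)

-- The word of a partition with first row a and further rows xs, without its leading false.
encode : ℕ → List ℕ → Word
encode a []       = replicate a true
encode a (b ∷ xs) = replicate (a ∸ b) true ++ false ∷ encode b xs

ones-trues++ : ∀ n v → ones (replicate n true ++ v) ≡ n + ones v
ones-trues++ zero    v = refl
ones-trues++ (suc n) v = cong suc (ones-trues++ n v)

shape-trues++ : ∀ n v → shape (replicate n true ++ v) ≡ shape v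
shape-trues++ zero    v = refl
shape-trues++ (suc n) v = shape-trues++ n v

shape-encode : ∀ a xs → 0 < a → All (0 <_) xs → Decreasing (a ∷ xs) →
  ones (encode a xs) ≡ a × shape (false ∷ encode a xs) ≡ a ∷ xs
shape-encode (suc a) [] _ _ _ =
  ones≡ , cong₂ prependRow ones≡ (trans (cong shape trues≡) (shape-trues++ (suc a) []))
  where
  trues≡ : replicate (suc a) true ≡ replicate (suc a) true ++ []
  trues≡ = sym (++-identityʳ _)
  ones≡ : ones (replicate (suc a) true) ≡ suc a
  ones≡ = trans (cong ones trues≡) (trans (ones-trues++ (suc a) []) (+-identityʳ (suc a)))
shape-encode (suc a) (b ∷ xs) _ (0<b ∷ xs>0) (b≤a , dec) with shape-encode b xs 0<b xs>0 dec
... | onesb , shapeb = ones≡ , trans (cong (λ n → prependRow n (shape (encode (suc a) (b ∷ xs)))) ones≡)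
                                     (cong (suc a ∷_) (trans (shape-trues++ (suc a ∸ b) _) shapeb))
  where
  ones≡ : ones (encode (suc a) (b ∷ xs)) ≡ suc a
  ones≡ = trans (ones-trues++ (suc a ∸ b) _) (trans (cong (suc a ∸ b +_) onesb) (m∸n+n≡m b≤a))

pred-2^ : ∀ K → suc (pred (2 ^ K)) ≡ 2 ^ K
pred-2^ K = suc-pred (2 ^ K) {{m^n≢0 2 K}}

odd-2^⇒isHook : ∀ K μ → IsPartition μ → size μ ≡ 2 ^ K → parity (f μ) ≡ true → IsHook μ
odd-2^⇒isHook K []       _                       |μ|≡2^K _   = ⊥-elim (<-irrefl |μ|≡2^K (m^n>0 2 K))
odd-2^⇒isHook K (a ∷ xs) (a>0 ∷ xs>0 , a∷xs-dec) |μ|≡2^K odd =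
  subst IsHook shape≡ (isHook-shape-false∷ k w survives)
  where
  open ≡-Reasoning
  w = encode a xs
  k = pred (2 ^ K)
  shape≡ : shape (false ∷ w) ≡ a ∷ xs
  shape≡ = proj₂ (shape-encode a xs a>0 xs>0 a∷xs-dec)
  survives : bit w k ∧ descending (setBit w k false) ≡ true
  survives = begin
      bit w k ∧ descending (setBit w k false)
    ≡⟨ sym (hookOp-descending-false∷ (length w) k w) ⟩
      hookOp (length (false ∷ w)) (suc k) descending (false ∷ w)
    ≡⟨ cong (λ n → hookOp (length (false ∷ w)) n descending (false ∷ w)) (pred-2^ K) ⟩
      hookOp (length (false ∷ w)) (2 ^ K) descending (false ∷ w)
    ≡⟨ sym (parity-f-2^ K (false ∷ w) shape≡ |μ|≡2^K) ⟩
      parity (f (a ∷ xs))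
    ≡⟨ odd ⟩
      true ∎

hookWord : ℕ → ℕ → Word
hookWord a b = replicate a true ++ replicate b false ++ true ∷ []

ones-falses++ : ∀ n v → ones (replicate n false ++ v) ≡ ones v
ones-falses++ zero    v = refl
ones-falses++ (suc n) v = ones-falses++ n v

shape-falses-true : ∀ b → shape (replicate b false ++ true ∷ []) ≡ replicate b 1
shape-falses-true zero    = refl
shape-falses-true (suc b) = cong₂ prependRow (ones-falses++ b (true ∷ [])) (shape-falses-true b)

shape-hookWord : ∀ a b → shape (false ∷ hookWord a b) ≡ suc a ∷ replicate b 1
shape-hookWord a b = cong₂ prependRow
  (trans (ones-trues++ a _) (trans (cong (a +_) (ones-falses++ b (true ∷ []))) (+-comm a 1)))
  (trans (shape-trues++ a _) (shape-falses-true b))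

bit-hookWord : ∀ a b → bit (hookWord a b) (a + b) ≡ true
bit-hookWord zero    zero    = refl
bit-hookWord zero    (suc b) = bit-hookWord zero b
bit-hookWord (suc a) b       = bit-hookWord a b

setBit-hookWord : ∀ a b → setBit (hookWord a b) (a + b) false ≡ replicate a true ++ replicate (suc b) false
setBit-hookWord zero    zero    = refl
setBit-hookWord zero    (suc b) = cong (false ∷_) (setBit-hookWord zero b)
setBit-hookWord (suc a) b       = cong (true ∷_) (setBit-hookWord a b)

descending-trues-falses : ∀ a b → descending (replicate a true ++ replicate b false) ≡ true
descending-trues-falses (suc a) b       = descending-trues-falses a b
descending-trues-falses zero    zero    = refl
descending-trues-falses zero    (suc b) = all-not-falses b
  where
  all-not-falses : ∀ b → all not (replicate b false) ≡ true
  all-not-falses zero    = refl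
  all-not-falses (suc b) = all-not-falses b

size-colPart : ∀ n → size (colPart n) ≡ n
size-colPart zero    = refl
size-colPart (suc n) = cong suc (size-colPart n)

size-hook : ∀ a b → size (suc a ∷ replicate b 1) ≡ suc (a + b)
size-hook a b = cong (λ n → suc (a + n)) (size-colPart b)

isHook-2^⇒odd : ∀ K a b → size (suc a ∷ replicate b 1) ≡ 2 ^ K → parity (f (suc a ∷ replicate b 1)) ≡ true
isHook-2^⇒odd K a b |μ|≡2^K = begin
    parity (f (suc a ∷ replicate b 1))
  ≡⟨ parity-f-2^ K (false ∷ hookWord a b) (shape-hookWord a b) |μ|≡2^K ⟩
    hookOp (length (false ∷ hookWord a b)) (2 ^ K) descending (false ∷ hookWord a b)
  ≡⟨ cong (λ n → hookOp (length (false ∷ hookWord a b)) n descending (false ∷ hookWord a b))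
          (trans (sym |μ|≡2^K) (size-hook a b)) ⟩
    hookOp (length (false ∷ hookWord a b)) (suc (a + b)) descending (false ∷ hookWord a b)
  ≡⟨ hookOp-descending-false∷ (length (hookWord a b)) (a + b) (hookWord a b) ⟩
    bit (hookWord a b) (a + b) ∧ descending (setBit (hookWord a b) (a + b) false)
  ≡⟨ cong₂ _∧_ (bit-hookWord a b) (cong descending (setBit-hookWord a b)) ⟩
    descending (replicate a true ++ replicate (suc b) false)
  ≡⟨ descending-trues-falses a (suc b) ⟩
    true ∎
  where open ≡-Reasoning

corners-thickHook : ∀ a b → corners (suc (suc a) ∷ replicate (suc b) 1) ≡
  (suc a ∷ replicate (suc b) 1) ∷ (suc (suc a) ∷ replicate b 1) ∷ []
corners-thickHook a b = cong ((suc a ∷ replicate (suc b) 1) ∷_) (cong (map (suc (suc a) ∷_)) (corners-column b))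
  where
  corners-column : ∀ b → corners (1 ∷ replicate b 1) ≡ replicate b 1 ∷ []
  corners-column zero    = refl
  corners-column (suc b) = cong (map (1 ∷_)) (corners-column b)

-- Both corners of a hook with arm and leg leave a hook of size 2^K behind.
thickHook-2^+1⇒even : ∀ K a b → size (suc (suc a) ∷ replicate (suc b) 1) ≡ suc (2 ^ K) →
  parity (f (suc (suc a) ∷ replicate (suc b) 1)) ≡ false
thickHook-2^+1⇒even K a b |μ|≡1+2^K = begin
    parity (f (suc (suc a) ∷ replicate (suc b) 1))
  ≡⟨ cong (λ n → parity (sytCount n (suc (suc a) ∷ replicate (suc b) 1))) |μ|≡1+2^K ⟩
    parity (sum (map (sytCount (2 ^ K)) (corners (suc (suc a) ∷ replicate (suc b) 1))))
  ≡⟨ cong (λ cs → parity (sum (map (sytCount (2 ^ K)) cs))) (corners-thickHook a b) ⟩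
    parity (sytCount (2 ^ K) armShorter + (sytCount (2 ^ K) legShorter + 0))
  ≡⟨ parity-+ (sytCount (2 ^ K) armShorter) _ ⟩
    parity (sytCount (2 ^ K) armShorter) xor parity (sytCount (2 ^ K) legShorter + 0)
  ≡⟨ cong₂ _xor_ (odd-2^ armShorter |arm|≡2^K (isHook-2^⇒odd K a (suc b) |arm|≡2^K))
                 (trans (cong parity (+-identityʳ (sytCount (2 ^ K) legShorter))) (odd-2^ legShorter |leg|≡2^K (isHook-2^⇒odd K (suc a) b |leg|≡2^K))) ⟩
    false ∎
  where
  open ≡-Reasoning
  armShorter legShorter : List ℕ
  armShorter = suc a ∷ replicate (suc b) 1
  legShorter = suc (suc a) ∷ replicate b 1
  |arm|≡2^K : size armShorter ≡ 2 ^ K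
  |arm|≡2^K = suc-injective |μ|≡1+2^K
  |leg|≡2^K : size legShorter ≡ 2 ^ K
  |leg|≡2^K = trans (cong suc (sym (+-suc a (size (replicate b 1))))) (suc-injective |μ|≡1+2^K)
  odd-2^ : ∀ μ → size μ ≡ 2 ^ K → parity (f μ) ≡ true → parity (sytCount (2 ^ K) μ) ≡ true
  odd-2^ μ |μ|≡2^K = subst (λ n → parity (sytCount n μ) ≡ true) |μ|≡2^K

-- Rays

⊆ₚ-refl : ∀ μ → μ ⊆ₚ μ
⊆ₚ-refl []      = []⊆
⊆ₚ-refl (x ∷ μ) = ∷⊆ ≤-refl (⊆ₚ-refl μ)

⊆ₚ-trans : ∀ {μ ν ρ} → μ ⊆ₚ ν → ν ⊆ₚ ρ → μ ⊆ₚ ρ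
⊆ₚ-trans []⊆        _          = []⊆
⊆ₚ-trans (∷⊆ a≤b p) (∷⊆ b≤c q) = ∷⊆ (≤-trans a≤b b≤c) (⊆ₚ-trans p q)

⊆ₚ-colPart : ∀ {μ} n → μ ⊆ₚ colPart n → All (0 <_) μ → μ ≡ colPart (length μ)
⊆ₚ-colPart zero    []⊆                 _               = refl
⊆ₚ-colPart (suc n) []⊆                 _               = refl
⊆ₚ-colPart (suc n) (∷⊆ (s≤s z≤n) μ⊆) (s≤s z≤n ∷ μ>0) = cong (1 ∷_) (⊆ₚ-colPart n μ⊆ μ>0)

RowOrColumn : List ℕ → Set
RowOrColumn μ = μ ≡ rowPart (size μ) ⊎ μ ≡ colPart (size μ)

row-rowOrColumn : ∀ c → RowOrColumn (suc c ∷ [])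
row-rowOrColumn c = inj₁ (cong (λ n → suc n ∷ []) (sym (+-identityʳ c)))

column-rowOrColumn : ∀ {μ} n → μ ≡ colPart n → RowOrColumn μ
column-rowOrColumn n refl = inj₂ (cong colPart (sym (size-colPart n)))

⊆ₚ-rowPart : ∀ {μ} n → μ ⊆ₚ rowPart n → All (0 <_) μ → RowOrColumn μ
⊆ₚ-rowPart zero    []⊆          _             = inj₁ refl
⊆ₚ-rowPart (suc n) []⊆          _             = inj₁ refl
⊆ₚ-rowPart (suc n) (∷⊆ _ []⊆) (s≤s z≤n ∷ _) = row-rowOrColumn _

⊆ₚ-rowOrColumn : ∀ {μ ν} → μ ⊆ₚ ν → All (0 <_) μ → RowOrColumn ν → RowOrColumn μ
⊆ₚ-rowOrColumn {μ} {ν} μ⊆ν μ>0 (inj₁ ν-row) = ⊆ₚ-rowPart (size ν) (subst (μ ⊆ₚ_) ν-row μ⊆ν) μ>0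
⊆ₚ-rowOrColumn {μ} {ν} μ⊆ν μ>0 (inj₂ ν-col) =
  column-rowOrColumn (length μ) (⊆ₚ-colPart (size ν) (subst (μ ⊆ₚ_) ν-col μ⊆ν) μ>0)

⊆ₚ-hook : ∀ {μ} a b → μ ⊆ₚ (suc a ∷ replicate b 1) → All (0 <_) μ → μ ≡ [] ⊎ IsHook μ
⊆ₚ-hook a b []⊆                     _           = inj₁ refl
⊆ₚ-hook a b (∷⊆ {suc c} {μ = μ} _ μ⊆) (_ ∷ μ>0) = inj₂ (c , length μ , cong (suc c ∷_) (⊆ₚ-colPart b μ⊆ μ>0))

oddHook-2^+1⇒rowOrColumn : ∀ K μ → IsHook μ → size μ ≡ suc (2 ^ K) → parity (f μ) ≡ true → RowOrColumn μ
oddHook-2^+1⇒rowOrColumn K _ (c     , zero  , refl) _   _   = row-rowOrColumn c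
oddHook-2^+1⇒rowOrColumn K _ (zero  , suc l , refl) _   _   = column-rowOrColumn (suc (suc l)) refl
oddHook-2^+1⇒rowOrColumn K _ (suc c , suc l , refl) |μ| odd with () ← trans (sym (thickHook-2^+1⇒even K c l |μ|)) odd

n≤2^n : ∀ n → n ≤ 2 ^ n
n≤2^n zero    = z≤n
n≤2^n (suc n) = subst (_≤ 2 ^ suc n) (+-comm n 1) (+-mono-≤ (n≤2^n n) (≤-trans (m^n>0 2 n) (m≤m+n (2 ^ n) 0)))

1+2^n≤2^[1+n] : ∀ n → suc (2 ^ n) ≤ 2 ^ suc n
1+2^n≤2^[1+n] n = subst (_≤ 2 ^ suc n) (+-comm (2 ^ n) 1) (+-monoʳ-≤ (2 ^ n) (≤-trans (m^n>0 2 n) (m≤m+n (2 ^ n) 0)))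

rowPart₂⊈colPart : ∀ n → ¬ (rowPart 2 ⊆ₚ colPart n)
rowPart₂⊈colPart (suc n) (∷⊆ (s≤s ()) _)

colPart₂⊈rowPart : ∀ n → ¬ (colPart 2 ⊆ₚ rowPart n)
colPart₂⊈rowPart (suc n) (∷⊆ _ ())

module Ray {r : ℕ → List ℕ} (ray : IsRay r) where

  covers : ∀ n → r n ⋖ r (suc n)
  covers = proj₂ (proj₂ ray)

  partition : ∀ n → IsPartition (r n)
  partition n = proj₁ (proj₁ (proj₂ ray) n)

  positive : ∀ n → All (0 <_) (r n)
  positive n = proj₁ (partition n)

  odd : ∀ n → parity (f (r n)) ≡ true
  odd n = %2≡1⇒parity (f (r n)) (proj₂ (proj₁ (proj₂ ray) n))

  size-ray : ∀ n → size (r n) ≡ n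
  size-ray zero    = cong size (proj₁ ray)
  size-ray (suc n) = trans (proj₂ (covers n)) (cong suc (size-ray n))

  ray-mono : ∀ {m n} → m ≤ n → r m ⊆ₚ r n
  ray-mono m≤n = ray-mono′ (≤⇒≤′ m≤n)
    where
    ray-mono′ : ∀ {m n} → m ≤′ n → r m ⊆ₚ r n
    ray-mono′ ≤′-refl        = ⊆ₚ-refl _
    ray-mono′ (≤′-step m≤′n) = ⊆ₚ-trans (ray-mono′ m≤′n) (proj₁ (covers _))

  ray-1+2^-rowOrColumn : ∀ K → RowOrColumn (r (suc (2 ^ K)))
  ray-1+2^-rowOrColumn K
    with a , b , r≡hook ← odd-2^⇒isHook (suc K) _ (partition _) (size-ray _) (odd (2 ^ suc K))
    with ⊆ₚ-hook a b (subst (r (suc (2 ^ K)) ⊆ₚ_) r≡hook (ray-mono (1+2^n≤2^[1+n] K))) (positive _)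
  ... | inj₁ r≡[] with () ← trans (sym (size-ray _)) (cong size r≡[])
  ... | inj₂ hook = oddHook-2^+1⇒rowOrColumn K _ hook (size-ray _) (odd _)

  ray-rowOrColumn : ∀ n → r n ≡ rowPart n ⊎ r n ≡ colPart n
  ray-rowOrColumn n = subst (λ m → r n ≡ rowPart m ⊎ r n ≡ colPart m) (size-ray n) (
    ⊆ₚ-rowOrColumn (ray-mono (≤-trans (n≤2^n n) (n≤1+n (2 ^ n)))) (positive n) (ray-1+2^-rowOrColumn n))

  row₂⇒row : r 2 ≡ rowPart 2 → ∀ n → r n ≡ rowPart n
  row₂⇒row r₂ n with ray-rowOrColumn n
  ... | inj₁ row = row
  row₂⇒row r₂ zero          | inj₂ col = col
  row₂⇒row r₂ (suc zero)    | inj₂ col = col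
  row₂⇒row r₂ (suc (suc n)) | inj₂ col =
    ⊥-elim (rowPart₂⊈colPart (suc (suc n)) (subst₂ _⊆ₚ_ r₂ col (ray-mono (s≤s (s≤s z≤n)))))

  col₂⇒col : r 2 ≡ colPart 2 → ∀ n → r n ≡ colPart n
  col₂⇒col r₂ n with ray-rowOrColumn n
  ... | inj₂ col = col
  col₂⇒col r₂ zero          | inj₁ row = row
  col₂⇒col r₂ (suc zero)    | inj₁ row = row
  col₂⇒col r₂ (suc (suc n)) | inj₁ row =
    ⊥-elim (colPart₂⊈rowPart (suc (suc n)) (subst₂ _⊆ₚ_ r₂ row (ray-mono (s≤s (s≤s z≤n)))))

theorem3p5 : (r : ℕ → List ℕ) → IsRay r →
    ((∀ n → r n ≡ rowPart n) ⊎ (∀ n → r n ≡ colPart n))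
theorem3p5 r ray with Ray.ray-rowOrColumn ray 2
... | inj₁ r₂-row = inj₁ (Ray.row₂⇒row ray r₂-row)
... | inj₂ r₂-col = inj₂ (Ray.col₂⇒col ray r₂-col)
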